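{- Let $G$ be a finite simple connected graph with $n$ vertices $v_1,\dots,v_n$. Then $$\frac{M_1(G)}{n} \le \frac{1}{M_1(G)}\sum_{i=1}^n (d_i\mu_i)^2,$$ with equality if $G$ is regular or semiregular.
   Context: All graphs are finite, simple and connected with $n\ge 3$ vertices; $d_i$ is the degree of $v_i$ and $\mu_i$ is the average of the degrees of the vertices adjacent to $v_i$. The first Zagreb index is $M_1(G)=\sum_{i=1}^n d_i^2$. A graph is regular if all vertices have the same degree. A connected graph is bidegreed with degrees $\Delta>\delta$ if every vertex has degree $\Delta$ or $\delta$ and both occur; a semiregular graph is a connected bidegreed bipartite graph in which all vertices in the same part of the bipartition have the same degree. -}

module Defs where

open import Data.Nat using (ℕ; zero; suc; _+_; _*_; _≤_; _≥_; _<_)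
open import Data.Fin using (Fin; zero; suc)
open import Data.Bool using (Bool; true; false; if_then_else_)
open import Data.Product using (Σ; ∃; _×_; _,_)
open import Relation.Binary.PropositionalEquality using (_≡_; _≢_)

sumFin : {n : ℕ} → (Fin n → ℕ) → ℕ
sumFin {zero}  f = 0
sumFin {suc n} f = f zero + sumFin (λ i → f (suc i))

record Graph (n : ℕ) : Set where
  field
    adj   : Fin n → Fin n → Bool
    sym   : ∀ i j → adj i j ≡ adj j i
    irrefl : ∀ i → adj i i ≡ false

open Graph public

data Walk {n : ℕ} (G : Graph n) : Fin n → Fin n → Set where
  here : ∀ {u} → Walk G u u
  step : ∀ {u w v} → adj G u w ≡ true → Walk G w v → Walk G u v

Connected : {n : ℕ} → Graph n → Set
Connected G = ∀ u v → Walk G u v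

deg : {n : ℕ} → Graph n → Fin n → ℕ
deg G i = sumFin (λ j → if adj G i j then 1 else 0)

M1 : {n : ℕ} → Graph n → ℕ
M1 G = sumFin (λ i → deg G i * deg G i)

-- d_i * μ_i = sum of the degrees of the neighbours of v_i
-- (μ_i is the average of these d_i neighbour degrees)
dμ : {n : ℕ} → Graph n → Fin n → ℕ
dμ G i = sumFin (λ j → if adj G i j then deg G j else 0)

Regular : {n : ℕ} → Graph n → Set
Regular G = ∃ λ k → ∀ i → deg G i ≡ k

Semiregular : {n : ℕ} → Graph n → Set
Semiregular {n} G =
  Connected G ×
  Σ (Fin n → Bool) λ c →
    (∀ i j → adj G i j ≡ true → c i ≢ c j) ×
    Σ ℕ λ a → Σ ℕ λ b →
      a ≢ b ×
      (∀ i → c i ≡ true → deg G i ≡ a) ×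
      (∀ i → c i ≡ false → deg G i ≡ b) ×
      (∃ λ i → deg G i ≡ a) × (∃ λ i → deg G i ≡ b)

-- Counting every edge from both ends gives Σᵢ dᵢμᵢ = Σⱼ dⱼ² = M₁, so the
-- inequality M₁² ≤ n Σᵢ (dᵢμᵢ)² is Cauchy–Schwarz (Σᵢ xᵢ)² ≤ n Σᵢ xᵢ².
-- Equality holds when dᵢμᵢ is constant: d² in a k-regular graph, and the
-- product of the two part degrees in a semiregular one.
module Submission where

open import Defs hiding (sym)
open import Data.Nat using (ℕ; zero; suc; _+_; _*_; _≤_; _≥_; z≤n)
open import Data.Nat.Properties
open import Data.Nat.Tactic.RingSolver using (solve-∀)
open import Data.Fin using (Fin; zero; suc)
open import Data.Bool using (Bool; true; false; not; if_then_else_)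
open import Data.Sum using (_⊎_; inj₁; inj₂)
open import Data.Product using (∃; _×_; _,_)
open import Data.Empty using (⊥-elim)
open import Relation.Binary.PropositionalEquality

sumFin-cong : ∀ {n} {f g : Fin n → ℕ} → (∀ i → f i ≡ g i) → sumFin f ≡ sumFin g
sumFin-cong {zero}  f≡g = refl
sumFin-cong {suc n} f≡g = cong₂ _+_ (f≡g zero) (sumFin-cong (λ i → f≡g (suc i)))

sumFin-mono-≤ : ∀ {n} {f g : Fin n → ℕ} → (∀ i → f i ≤ g i) → sumFin f ≤ sumFin g
sumFin-mono-≤ {zero}  f≤g = z≤n
sumFin-mono-≤ {suc n} f≤g = +-mono-≤ (f≤g zero) (sumFin-mono-≤ (λ i → f≤g (suc i)))

sumFin-+ : ∀ {n} (f g : Fin n → ℕ) →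
  sumFin (λ i → f i + g i) ≡ sumFin f + sumFin g
sumFin-+ {zero}  f g = refl
sumFin-+ {suc n} f g
  rewrite sumFin-+ (λ i → f (suc i)) (λ i → g (suc i)) =
  +-+-exchange (f zero) (g zero) (sumFin (λ i → f (suc i))) (sumFin (λ i → g (suc i)))
  where
  +-+-exchange : ∀ a b c d → a + b + (c + d) ≡ a + c + (b + d)
  +-+-exchange = solve-∀

sumFin-*ˡ : ∀ {n} (c : ℕ) (f : Fin n → ℕ) → sumFin (λ i → c * f i) ≡ c * sumFin f
sumFin-*ˡ {zero}  c f = sym (*-zeroʳ c)
sumFin-*ˡ {suc n} c f
  rewrite sumFin-*ˡ c (λ i → f (suc i)) = sym (*-distribˡ-+ c (f zero) _)

sumFin-const : ∀ {n} (c : ℕ) → sumFin {n} (λ _ → c) ≡ n * c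
sumFin-const {zero}  c = refl
sumFin-const {suc n} c = cong (c +_) (sumFin-const {n} c)

sumFin-swap : ∀ {m n} (f : Fin m → Fin n → ℕ) →
  sumFin (λ i → sumFin (λ j → f i j)) ≡ sumFin (λ j → sumFin (λ i → f i j))
sumFin-swap {zero}  {n} f = sym (trans (sumFin-const {n} 0) (*-zeroʳ n))
sumFin-swap {suc m} {n} f =
  trans (cong (sumFin (f zero) +_) (sumFin-swap (λ i → f (suc i))))
        (sym (sumFin-+ (f zero) (λ j → sumFin (λ i → f (suc i) j))))

sumFin-*-sumFin : ∀ {n} (f g : Fin n → ℕ) →
  sumFin f * sumFin g ≡ sumFin (λ i → sumFin (λ j → f i * g j))
sumFin-*-sumFin f g = begin
  sumFin f * sumFin g                       ≡⟨ *-comm (sumFin f) (sumFin g) ⟩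
  sumFin g * sumFin f                       ≡⟨ sumFin-*ˡ (sumFin g) f ⟨
  sumFin (λ i → sumFin g * f i)             ≡⟨ sumFin-cong (λ i → *-comm (sumFin g) (f i)) ⟩
  sumFin (λ i → f i * sumFin g)             ≡⟨ sumFin-cong (λ i → sumFin-*ˡ (f i) g) ⟨
  sumFin (λ i → sumFin (λ j → f i * g j))   ∎
  where open ≡-Reasoning

2*m*n≤m*m+n*n : ∀ m n → 2 * (m * n) ≤ m * m + n * n
2*m*n≤m*m+n*n zero    n       = z≤n
2*m*n≤m*m+n*n (suc m) zero    = ≤-trans (≤-reflexive (cong (2 *_) (*-zeroʳ (suc m)))) z≤n
2*m*n≤m*m+n*n (suc m) (suc n) = begin
  2 * (suc m * suc n)                    ≡⟨ expand-lhs m n ⟩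
  2 * (m * n) + (2 * m + 2 * n + 2)      ≤⟨ +-monoˡ-≤ _ (2*m*n≤m*m+n*n m n) ⟩
  m * m + n * n + (2 * m + 2 * n + 2)    ≡⟨ expand-rhs m n ⟨
  suc m * suc m + suc n * suc n          ∎
  where
  open ≤-Reasoning
  expand-lhs : ∀ m n → 2 * ((1 + m) * (1 + n)) ≡ 2 * (m * n) + (2 * m + 2 * n + 2)
  expand-lhs = solve-∀
  expand-rhs : ∀ m n → (1 + m) * (1 + m) + (1 + n) * (1 + n) ≡ m * m + n * n + (2 * m + 2 * n + 2)
  expand-rhs = solve-∀

-- Expand (Σ f)² as the double sum Σᵢ Σⱼ fᵢ fⱼ and bound each term by (fᵢ² + fⱼ²)/2.
sumFin²≤n*sumFin-squares : ∀ {n} (f : Fin n → ℕ) →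
  sumFin f * sumFin f ≤ n * sumFin (λ i → f i * f i)
sumFin²≤n*sumFin-squares {n} f = *-cancelˡ-≤ 2 (begin
  2 * (sumFin f * sumFin f)
    ≡⟨ cong (2 *_) (sumFin-*-sumFin f f) ⟩
  2 * ΣΣ (λ i j → f i * f j)
    ≡⟨ 2*ΣΣ ⟨
  ΣΣ (λ i j → 2 * (f i * f j))
    ≤⟨ sumFin-mono-≤ (λ i → sumFin-mono-≤ (λ j → 2*m*n≤m*m+n*n (f i) (f j))) ⟩
  ΣΣ (λ i j → f i * f i + f j * f j)
    ≡⟨ sumFin-cong (λ i → sumFin-+ (λ _ → f i * f i) (λ j → f j * f j)) ⟩
  sumFin (λ i → sumFin {n} (λ _ → f i * f i) + Q)
    ≡⟨ sumFin-+ (λ i → sumFin {n} (λ _ → f i * f i)) (λ _ → Q) ⟩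
  sumFin (λ i → sumFin {n} (λ _ → f i * f i)) + sumFin {n} (λ _ → Q)
    ≡⟨ cong₂ _+_ outer-constant (sumFin-const {n} Q) ⟩
  n * Q + n * Q
    ≡⟨ cong (n * Q +_) (+-identityʳ (n * Q)) ⟨
  2 * (n * Q)
    ∎)
  where
  open ≤-Reasoning
  Q = sumFin (λ i → f i * f i)
  ΣΣ : (Fin n → Fin n → ℕ) → ℕ
  ΣΣ g = sumFin (λ i → sumFin (λ j → g i j))
  2*ΣΣ : ΣΣ (λ i j → 2 * (f i * f j)) ≡ 2 * ΣΣ (λ i j → f i * f j)
  2*ΣΣ = trans (sumFin-cong (λ i → sumFin-*ˡ 2 (λ j → f i * f j)))
               (sumFin-*ˡ 2 (λ i → sumFin (λ j → f i * f j)))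
  outer-constant : sumFin (λ i → sumFin {n} (λ _ → f i * f i)) ≡ n * Q
  outer-constant = trans (sumFin-cong (λ i → sumFin-const {n} (f i * f i)))
                         (sumFin-*ˡ n (λ i → f i * f i))

sumFin²≡n*sumFin-squares : ∀ {n} (f : Fin n → ℕ) (c : ℕ) → (∀ i → f i ≡ c) →
  sumFin f * sumFin f ≡ n * sumFin (λ i → f i * f i)
sumFin²≡n*sumFin-squares {n} f c f≡c
  rewrite sumFin-cong f≡c
        | sumFin-cong (λ i → cong₂ _*_ (f≡c i) (f≡c i))
        | sumFin-const {n} c | sumFin-const {n} (c * c) = square-of-product n c
  where
  square-of-product : ∀ n c → n * c * (n * c) ≡ n * (n * (c * c))
  square-of-product = solve-∀

-- dμ G = neighbourSum G (deg G) and deg G = neighbourSum G (λ _ → 1), both definitionally.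
neighbourSum : ∀ {n} → Graph n → (Fin n → ℕ) → Fin n → ℕ
neighbourSum G f i = sumFin (λ j → if adj G i j then f j else 0)

if-then-else-0≡*indicator : ∀ (b : Bool) x → (if b then x else 0) ≡ x * (if b then 1 else 0)
if-then-else-0≡*indicator true  x = sym (*-identityʳ x)
if-then-else-0≡*indicator false x = sym (*-zeroʳ x)

sumFin-neighbourSum : ∀ {n} (G : Graph n) (f : Fin n → ℕ) →
  sumFin (neighbourSum G f) ≡ sumFin (λ j → f j * deg G j)
sumFin-neighbourSum G f =
  trans (sumFin-swap (λ i j → if adj G i j then f j else 0)) (sumFin-cong (λ j →
  trans (sumFin-cong (λ i → trans (if-then-else-0≡*indicator (adj G i j) (f j))
                                  (cong (λ b → f j * (if b then 1 else 0)) (Graph.sym G i j))))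
        (sumFin-*ˡ (f j) (λ i → if adj G j i then 1 else 0))))

sumFin-dμ≡M1 : ∀ {n} (G : Graph n) → sumFin (dμ G) ≡ M1 G
sumFin-dμ≡M1 G = sumFin-neighbourSum G (deg G)

neighbourSum-const : ∀ {n} (G : Graph n) (f : Fin n → ℕ) (c : ℕ) (i : Fin n) →
  (∀ j → adj G i j ≡ true → f j ≡ c) → neighbourSum G f i ≡ c * deg G i
neighbourSum-const G f c i f≡c =
  trans (sumFin-cong term) (sumFin-*ˡ c (λ j → if adj G i j then 1 else 0))
  where
  term : ∀ j → (if adj G i j then f j else 0) ≡ c * (if adj G i j then 1 else 0)
  term j with adj G i j in ij
  ... | true  = trans (f≡c j ij) (sym (*-identityʳ c))
  ... | false = sym (*-zeroʳ c)

neighbour-colour : ∀ {n} (G : Graph n) (c : Fin n → Bool) →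
  (∀ i j → adj G i j ≡ true → c i ≢ c j) →
  ∀ {i j} → adj G i j ≡ true → c j ≡ not (c i)
neighbour-colour G c proper {i} {j} ij with c i in ci | c j in cj
... | true  | false = refl
... | false | true  = refl
... | true  | true  = ⊥-elim (proper i j ij (trans ci (sym cj)))
... | false | false = ⊥-elim (proper i j ij (trans ci (sym cj)))

dμ-constant : ∀ {n} (G : Graph n) → Regular G ⊎ Semiregular G →
  ∃ λ c → ∀ i → dμ G i ≡ c
dμ-constant G (inj₁ (k , deg≡k)) =
  k * k , λ i → trans (neighbourSum-const G (deg G) k i (λ j _ → deg≡k j)) (cong (k *_) (deg≡k i))
dμ-constant G (inj₂ (_ , c , proper , a , b , _ , deg-true , deg-false , _)) = b * a , dμ≡b*a
  where
  dμ≡b*a : ∀ i → dμ G i ≡ b * a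
  dμ≡b*a i with c i in ci
  ... | true  = trans (neighbourSum-const G (deg G) b i (λ j ij →
                  deg-false j (trans (neighbour-colour G c proper ij) (cong not ci))))
                (cong (b *_) (deg-true i ci))
  ... | false = trans (neighbourSum-const G (deg G) a i (λ j ij →
                  deg-true j (trans (neighbour-colour G c proper ij) (cong not ci))))
                (trans (cong (a *_) (deg-false i ci)) (*-comm a b))

proposition6 : (n : ℕ) → n ≥ 3 → (G : Graph n) → Connected G →
    (M1 G * M1 G ≤ n * sumFin (λ i → dμ G i * dμ G i)) ×
    (Regular G ⊎ Semiregular G →
      M1 G * M1 G ≡ n * sumFin (λ i → dμ G i * dμ G i))
proposition6 n _ G _ =
  subst (λ m → m * m ≤ n * squares) (sumFin-dμ≡M1 G) (sumFin²≤n*sumFin-squares (dμ G)) ,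
  λ regular-or-semiregular →
    let (c , dμ≡c) = dμ-constant G regular-or-semiregular in
    subst (λ m → m * m ≡ n * squares) (sumFin-dμ≡M1 G) (sumFin²≡n*sumFin-squares (dμ G) c dμ≡c)
  where
  squares : ℕ
  squares = sumFin (λ i → dμ G i * dμ G i)
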